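{- The 1-type spectrum of a $\mathrm{GP}^2$ sentence is not always semilinear: there is a $\mathrm{GP}^2$ sentence $\varphi$ whose 1-type spectrum is not a semilinear set.
   Context: $\mathrm{GP}^2$ is the two-variable logic (variables $x,y$) over a vocabulary of unary and binary predicates, built from atomic formulas by Boolean connectives, unguarded unary quantification $\exists x\,\phi(x)$, and guarded Presburger quantifiers $\big(\sum_t\kappa_t\cdot\#_y[\phi_t(x,y)]\big)\circledast\delta$ where each $\phi_t$ has the form $R(x,y)\wedge\psi$ or $R(y,x)\wedge\psi$ for a binary predicate $R$, $\kappa_t,\delta\in\mathbb{Z}$, $\circledast$ an (in)equality, and $\#_y[\phi(x,y)]$ at $a$ denotes the number of $b$ with $\phi(a,b)$. With unary predicates $U_1,\dots,U_n$ and binary predicates $R_1,\dots,R_m$, a 1-type is a maximal consistent subset of $\{U_i(x),\neg U_i(x)\}_{i\le n}\cup\{R_i(x,x),\neg R_i(x,x)\}_{i\le m}$; the 1-type spectrum of a sentence is the set of vectors (indexed by 1-types in a fixed order) counting, for each finite model, how many elements realize each 1-type. A set of vectors of naturals is semilinear if it is a finite union of linear sets $\{b+\sum_j\lambda_jp_j:\lambda_j\in\mathbb{N}\}$ (equivalently Presburger definable). -}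

module Defs where

open import Data.Bool using (Bool; true; false; _∧_; _∨_; not; if_then_else_; _xor_)
open import Data.Nat using (ℕ; zero; suc; _+_; _*_)
open import Data.Fin using (Fin; zero; suc)
open import Data.Integer as ℤ using (ℤ; +_; _≤ᵇ_)
open import Data.Product using (Σ; _×_; _,_; proj₁; proj₂; ∃)
open import Relation.Binary.PropositionalEquality using (_≡_)
open import Data.Unit using (⊤)

sumFin : (k : ℕ) → (Fin k → ℕ) → ℕ
sumFin zero    f = 0
sumFin (suc k) f = f zero + sumFin k (λ i → f (suc i))

sumFinℤ : (k : ℕ) → (Fin k → ℤ) → ℤ
sumFinℤ zero    f = + 0
sumFinℤ (suc k) f = f zero ℤ.+ sumFinℤ k (λ i → f (suc i))

anyFin : (k : ℕ) → (Fin k → Bool) → Bool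
anyFin zero    f = false
anyFin (suc k) f = f zero ∨ anyFin k (λ i → f (suc i))

allFin : (k : ℕ) → (Fin k → Bool) → Bool
allFin zero    f = true
allFin (suc k) f = f zero ∧ allFin k (λ i → f (suc i))

countFin : (k : ℕ) → (Fin k → Bool) → ℕ
countFin k f = sumFin k (λ i → if f i then 1 else 0)

_==ᵇ_ : Bool → Bool → Bool
a ==ᵇ b = not (a xor b)

data Var : Set where
  vx vy : Var

other : Var → Var
other vx = vy
other vy = vx

_==ᵛ_ : Var → Var → Bool
vx ==ᵛ vx = true
vy ==ᵛ vy = true
_  ==ᵛ _  = false

-- direction of the guard: fwd means R(u,v), bwd means R(v,u), where
-- v is the counted variable and u = other v is the free one.
data Dir : Set where
  fwd bwd : Dir

data Cmp : Set where
  c= c≠ c< c≤ c> c≥ : Cmp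

data Formula (n m : ℕ) : Set where
  unary  : Fin n → Var → Formula n m
  binary : Fin m → Var → Var → Formula n m
  equal  : Var → Var → Formula n m
  neg    : Formula n m → Formula n m
  conj   : Formula n m → Formula n m → Formula n m
  disj   : Formula n m → Formula n m → Formula n m
  -- ∃v φ  (unguarded unary quantification; φ must have only v free, see WF)
  ex     : Var → Formula n m → Formula n m
  -- guarded Presburger quantifier counting the variable v:
  --   (Σ_{t<k} κ_t · #_v[φ_t]) ⊛ δ,  with φ_t = R_{r t}(u,v) ∧ ψ_t  (d t = fwd)
  --                                   or  φ_t = R_{r t}(v,u) ∧ ψ_t  (d t = bwd),
  --   u = other v.
  count  : (v : Var) (k : ℕ) (κ : Fin k → ℤ) (r : Fin k → Fin m)
           (d : Fin k → Dir) (ψ : Fin k → Formula n m) (c : Cmp) (δ : ℤ) →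
           Formula n m

free : ∀ {n m} → Formula n m → Var → Bool
free (unary i v)      w = v ==ᵛ w
free (binary i v v')  w = (v ==ᵛ w) ∨ (v' ==ᵛ w)
free (equal v v')     w = (v ==ᵛ w) ∨ (v' ==ᵛ w)
free (neg φ)          w = free φ w
free (conj φ ψ)       w = free φ w ∨ free ψ w
free (disj φ ψ)       w = free φ w ∨ free ψ w
free (ex v φ)         w = not (v ==ᵛ w) ∧ free φ w
free (count v k κ r d ψ c δ) w = other v ==ᵛ w

WF : ∀ {n m} → Formula n m → Set
WF (unary i v)     = ⊤
WF (binary i v w)  = ⊤
WF (equal v w)     = ⊤
WF (neg φ)         = WF φ
WF (conj φ ψ)      = WF φ × WF ψ
WF (disj φ ψ)      = WF φ × WF ψ
WF (ex v φ)        = (free φ (other v) ≡ false) × WF φ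
WF (count v k κ r d ψ c δ) = (t : Fin k) → WF (ψ t)

Sentence : ∀ {n m} → Formula n m → Set
Sentence φ = WF φ × (free φ vx ≡ false) × (free φ vy ≡ false)

record Structure (n m : ℕ) : Set where
  field
    N : ℕ                                  -- domain is Fin (suc N)
    U : Fin n → Fin (suc N) → Bool
    R : Fin m → Fin (suc N) → Fin (suc N) → Bool
open Structure public

Dom : ∀ {n m} → Structure n m → Set
Dom A = Fin (suc (N A))

upd : {D : Set} → (Var → D) → Var → D → (Var → D)
upd ρ v b w = if v ==ᵛ w then b else ρ w

cmpᵇ : Cmp → ℤ → ℤ → Bool
cmpᵇ c= a b = (a ≤ᵇ b) ∧ (b ≤ᵇ a)
cmpᵇ c≠ a b = not ((a ≤ᵇ b) ∧ (b ≤ᵇ a))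
cmpᵇ c< a b = not (b ≤ᵇ a)
cmpᵇ c≤ a b = a ≤ᵇ b
cmpᵇ c> a b = not (a ≤ᵇ b)
cmpᵇ c≥ a b = b ≤ᵇ a

varEqᵇ : ∀ {k} → Fin k → Fin k → Bool
varEqᵇ zero    zero    = true
varEqᵇ zero    (suc _) = false
varEqᵇ (suc _) zero    = false
varEqᵇ (suc a) (suc b) = varEqᵇ a b

eval : ∀ {n m} (A : Structure n m) → Formula n m → (Var → Dom A) → Bool
eval A (unary i v)    ρ = U A i (ρ v)
eval A (binary i v w) ρ = R A i (ρ v) (ρ w)
eval A (equal v w)    ρ = varEqᵇ (ρ v) (ρ w)
eval A (neg φ)        ρ = not (eval A φ ρ)
eval A (conj φ ψ)     ρ = eval A φ ρ ∧ eval A ψ ρ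
eval A (disj φ ψ)     ρ = eval A φ ρ ∨ eval A ψ ρ
eval A (ex v φ)       ρ = anyFin (suc (N A)) (λ b → eval A φ (upd ρ v b))
eval A (count v k κ r d ψ c δ) ρ =
  cmpᵇ c (sumFinℤ k (λ t → κ t ℤ.* (+ cnt t))) δ
  where
    guard : Dir → Fin _ → Dom A → Dom A → Bool
    guard fwd i a b = R A i a b
    guard bwd i a b = R A i b a
    cnt : Fin k → ℕ
    cnt t = countFin (suc (N A)) (λ b →
              guard (d t) (r t) (ρ (other v)) b ∧ eval A (ψ t) (upd ρ v b))

-- A ⊨ φ (for sentences the assignment is irrelevant)
_⊨_ : ∀ {n m} → Structure n m → Formula n m → Set
A ⊨ φ = (ρ : Var → Dom A) → eval A φ ρ ≡ true

-- 1-types: a maximal consistent set of literals U_i(x)/¬U_i(x),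
-- R_j(x,x)/¬R_j(x,x) is exactly a choice of polarity for each literal.

OneType : ℕ → ℕ → Set
OneType n m = (Fin n → Bool) × (Fin m → Bool)

realizes : ∀ {n m} (A : Structure n m) → Dom A → OneType n m → Bool
realizes {n} {m} A a τ =
  allFin n (λ i → U A i a ==ᵇ proj₁ τ i) ∧
  allFin m (λ j → R A j a a ==ᵇ proj₂ τ j)

Spectrum : ∀ {n m} → Formula n m → (OneType n m → ℕ) → Set
Spectrum {n} {m} φ v =
  Σ (Structure n m) λ A → (A ⊨ φ) ×
    ((τ : OneType n m) → v τ ≡ countFin (suc (N A)) (λ a → realizes A a τ))

record LinearSet (I : Set) : Set where
  field
    base    : I → ℕ
    nper    : ℕ
    period  : Fin nper → I → ℕ

_∈L_ : {I : Set} → (I → ℕ) → LinearSet I → Set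
v ∈L L = Σ (Fin (LinearSet.nper L) → ℕ) λ λs →
  ∀ i → v i ≡ LinearSet.base L i +
               sumFin (LinearSet.nper L) (λ j → λs j * LinearSet.period L j i)

Semilinear : {I : Set} → ((I → ℕ) → Set) → Set
Semilinear {I} S = Σ ℕ λ r → Σ (Fin r → LinearSet I) λ L →
  ∀ v → (S v → Σ (Fin r) λ j → v ∈L L j) × (Σ (Fin r) (λ j → v ∈L L j) → S v)

{-# OPTIONS --safe #-}
module Submission where

-- Write L(x) for the self-loop R(x,x). The sentence φ says that every looped element
-- has at least as many looped as loopless R-successors, and that every loopless element
-- has a looped R-predecessor. Double counting the edges from looped to loopless elements
-- bounds the number of loopless elements by the square of the number of looped ones,
-- and a looped elements, each feeding its own block of a loopless elements, show that
-- (a, a²) is attained. In a linear set inside {b ≤ a²}, a period that does not increase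
-- a cannot increase b either, so the set lies below a line b ≤ c + c·a; hence so does a
-- finite union of such sets, which therefore cannot contain every (a, a²).

open import Defs
open import Data.Nat using (ℕ)
open import Data.Product using (Σ; _×_)
open import Relation.Nullary using (¬_)

open import Data.Bool using (Bool; true; false; _∧_; _∨_; not; if_then_else_)
open import Data.Bool.Properties using (∧-identityʳ; ∧-comm; ∧-conicalʳ; ∨-identityʳ; not-injective; T-≡)
open import Data.Fin using (Fin; zero; suc; _↑ˡ_; _↑ʳ_; splitAt; remQuot; combine)
open import Data.Fin.Properties using (_≟_; suc-injective; splitAt-↑ˡ; splitAt-↑ʳ; remQuot-combine)
open import Data.Integer as ℤ using (-[1+_])
import Data.Integer.Properties as ℤ
open import Data.Nat using (zero; suc; _+_; _*_; _≤_; z≤n)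
open import Data.Nat.Properties
  using (+-*-semiring; +-assoc; +-identityʳ; *-comm; *-identityʳ; *-zeroʳ; ≤-refl; ≤-reflexive; ≤-trans;
         n<1+n; n≮n; n<1⇒n≡0; m≤m+n; m≤n+m; m≤m*n; +-mono-≤; +-monoʳ-≤; *-monoˡ-≤; *-monoʳ-≤;
         *-cancelˡ-<; module ≤-Reasoning)
open import Data.Product using (_,_; proj₁; proj₂)
open import Data.Sum using (_⊎_; inj₁; inj₂; map₂)
open import Data.Unit using (tt)
open import Data.Vec.Functional using ([]; _∷_)
open import Function using (_∘_; case_of_; _⇔_; mk⇔; Equivalence)
open import Relation.Binary.PropositionalEquality
open import Relation.Nullary.Decidable using (does; dec-true; dec-false)
open import Algebra.Properties.Semiring.Sum +-*-semiring using (sum; sum-cong-≗; ∑-comm; *-distribˡ-sum)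

open Equivalence using (to; from)

sumFin≡sum : ∀ n (f : Fin n → ℕ) → sumFin n f ≡ sum f
sumFin≡sum zero    f = refl
sumFin≡sum (suc n) f = cong (f zero +_) (sumFin≡sum n (f ∘ suc))

sumFin-cong : ∀ n {f g : Fin n → ℕ} → (∀ i → f i ≡ g i) → sumFin n f ≡ sumFin n g
sumFin-cong zero    f≗g = refl
sumFin-cong (suc n) f≗g = cong₂ _+_ (f≗g zero) (sumFin-cong n (f≗g ∘ suc))

sumFin-mono : ∀ n {f g : Fin n → ℕ} → (∀ i → f i ≤ g i) → sumFin n f ≤ sumFin n g
sumFin-mono zero    f≤g = z≤n
sumFin-mono (suc n) f≤g = +-mono-≤ (f≤g zero) (sumFin-mono n (f≤g ∘ suc))

sumFin-zero : ∀ n {f : Fin n → ℕ} → (∀ i → f i ≡ 0) → sumFin n f ≡ 0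
sumFin-zero zero    f≡0 = refl
sumFin-zero (suc n) f≡0 = cong₂ _+_ (f≡0 zero) (sumFin-zero n (f≡0 ∘ suc))

sumFin-const : ∀ n c → sumFin n (λ _ → c) ≡ n * c
sumFin-const zero    c = refl
sumFin-const (suc n) c = cong (c +_) (sumFin-const n c)

≤-sumFin : ∀ {n} (f : Fin n → ℕ) i → f i ≤ sumFin n f
≤-sumFin f zero    = m≤m+n _ _
≤-sumFin f (suc i) = ≤-trans (≤-sumFin (f ∘ suc) i) (m≤n+m _ _)

sumFin-supported : ∀ {n} (k : Fin n) (f : Fin n → ℕ) → (∀ j → j ≢ k → f j ≡ 0) → sumFin n f ≡ f k
sumFin-supported zero    f off-k =
  trans (cong (f zero +_) (sumFin-zero _ (λ j → off-k (suc j) (λ ())))) (+-identityʳ (f zero))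
sumFin-supported (suc k) f off-k =
  trans (cong (_+ sumFin _ (f ∘ suc)) (off-k zero (λ ())))
        (sumFin-supported k (f ∘ suc) (λ j j≢k → off-k (suc j) (j≢k ∘ suc-injective)))

sumFin-comm : ∀ m n (f : Fin m → Fin n → ℕ) →
              sumFin m (λ i → sumFin n (f i)) ≡ sumFin n (λ j → sumFin m (λ i → f i j))
sumFin-comm m n f = begin
  sumFin m (λ i → sumFin n (f i))      ≡⟨ sumFin≡sum m _ ⟩
  sum (λ i → sumFin n (f i))           ≡⟨ sum-cong-≗ (λ i → sumFin≡sum n (f i)) ⟩
  sum (λ i → sum (f i))                ≡⟨ ∑-comm f ⟩
  sum (λ j → sum (λ i → f i j))        ≡⟨ sum-cong-≗ (λ j → sumFin≡sum m (λ i → f i j)) ⟨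
  sum (λ j → sumFin m (λ i → f i j))   ≡⟨ sumFin≡sum n _ ⟨
  sumFin n (λ j → sumFin m (λ i → f i j)) ∎
  where open ≡-Reasoning

sumFin-*ˡ : ∀ n c (f : Fin n → ℕ) → c * sumFin n f ≡ sumFin n (λ i → c * f i)
sumFin-*ˡ n c f = begin
  c * sumFin n f           ≡⟨ cong (c *_) (sumFin≡sum n f) ⟩
  c * sum f                ≡⟨ *-distribˡ-sum c f ⟩
  sum (λ i → c * f i)      ≡⟨ sumFin≡sum n _ ⟨
  sumFin n (λ i → c * f i) ∎
  where open ≡-Reasoning

sumFin-↑ : ∀ m n (f : Fin (m + n) → ℕ) →
           sumFin (m + n) f ≡ sumFin m (λ i → f (i ↑ˡ n)) + sumFin n (λ j → f (m ↑ʳ j))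
sumFin-↑ zero    n f = refl
sumFin-↑ (suc m) n f = trans (cong (f zero +_) (sumFin-↑ m n (f ∘ suc))) (sym (+-assoc (f zero) _ _))

sumFin-combine : ∀ m n (f : Fin (m * n) → ℕ) →
                 sumFin (m * n) f ≡ sumFin m (λ i → sumFin n (λ j → f (combine i j)))
sumFin-combine zero    n f = refl
sumFin-combine (suc m) n f =
  trans (sumFin-↑ n (m * n) f) (cong (sumFin n (λ j → f (j ↑ˡ m * n)) +_) (sumFin-combine m n (f ∘ (n ↑ʳ_))))

decode : ∀ m n k → Fin (m + n * k) → Fin m ⊎ Fin n × Fin k
decode m n k = map₂ (remQuot {n} k) ∘ splitAt m

sumFin-decode : ∀ m n k (g : Fin m ⊎ Fin n × Fin k → ℕ) →
                sumFin (m + n * k) (g ∘ decode m n k)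
                  ≡ sumFin m (g ∘ inj₁) + sumFin n (λ i → sumFin k (λ j → g (inj₂ (i , j))))
sumFin-decode m n k g = trans (sumFin-↑ m (n * k) (g ∘ decode m n k))
  (cong₂ _+_ (sumFin-cong m (cong g ∘ decode-↑ˡ))
             (trans (sumFin-combine n k _) (sumFin-cong n (λ i → sumFin-cong k (cong g ∘ decode-↑ʳ i)))))
  where
  decode-↑ˡ : ∀ i → decode m n k (i ↑ˡ n * k) ≡ inj₁ i
  decode-↑ˡ i = cong (map₂ _) (splitAt-↑ˡ m i (n * k))
  decode-↑ʳ : ∀ i j → decode m n k (m ↑ʳ combine i j) ≡ inj₂ (i , j)
  decode-↑ʳ i j = trans (cong (map₂ _) (splitAt-↑ʳ m (n * k) (combine i j))) (cong inj₂ (remQuot-combine i j))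

countFin-cong : ∀ n {f g : Fin n → Bool} → (∀ i → f i ≡ g i) → countFin n f ≡ countFin n g
countFin-cong n f≗g = sumFin-cong n (λ i → cong (λ b → if b then 1 else 0) (f≗g i))

countFin-mono : ∀ n {f g : Fin n → Bool} → (∀ i → f i ≡ true → g i ≡ true) → countFin n f ≤ countFin n g
countFin-mono n f⇒g = sumFin-mono n (λ i → indicator-mono (f⇒g i))
  where
  indicator-mono : ∀ {b c} → (b ≡ true → c ≡ true) → (if b then 1 else 0) ≤ (if c then 1 else 0)
  indicator-mono {false} _   = z≤n
  indicator-mono {true}  b⇒c rewrite b⇒c refl = ≤-refl

countFin-true : ∀ n → countFin n (λ _ → true) ≡ n
countFin-true n = trans (sumFin-const n 1) (*-identityʳ n)

countFin-false : ∀ n → countFin n (λ _ → false) ≡ 0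
countFin-false n = sumFin-zero n (λ _ → refl)

1≤countFin : ∀ {n} {f : Fin n → Bool} i → f i ≡ true → 1 ≤ countFin n f
1≤countFin {n} {f} i fi = subst (λ b → (if b then 1 else 0) ≤ countFin n f) fi (≤-sumFin _ i)

double-counting : ∀ m n (P : Fin m → Bool) (Q : Fin n → Bool) (E : Fin m → Fin n → Bool) c →
                  (∀ x → Q x ≡ true → 1 ≤ countFin m (λ y → P y ∧ E y x)) →
                  (∀ y → P y ≡ true → countFin n (λ x → E y x ∧ Q x) ≤ c) →
                  countFin n Q ≤ c * countFin m P
double-counting m n P Q E c covered sparse = begin
  countFin n Q                                               ≤⟨ sumFin-mono n covered′ ⟩
  sumFin n (λ x → countFin m (λ y → (P y ∧ E y x) ∧ Q x))     ≡⟨ sumFin-comm n m _ ⟩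
  sumFin m (λ y → countFin n (λ x → (P y ∧ E y x) ∧ Q x))     ≤⟨ sumFin-mono m sparse′ ⟩
  sumFin m (λ y → c * (if P y then 1 else 0))                ≡⟨ sumFin-*ˡ m c _ ⟨
  c * countFin m P                                           ∎
  where
  open ≤-Reasoning
  covered′ : ∀ x → (if Q x then 1 else 0) ≤ countFin m (λ y → (P y ∧ E y x) ∧ Q x)
  covered′ x with Q x in Qx
  ... | false = z≤n
  ... | true  = ≤-trans (covered x Qx) (≤-reflexive (countFin-cong m (λ y → sym (∧-identityʳ _))))
  sparse′ : ∀ y → countFin n (λ x → (P y ∧ E y x) ∧ Q x) ≤ c * (if P y then 1 else 0)
  sparse′ y with P y in Py
  ... | false = ≤-reflexive (trans (countFin-false n) (sym (*-zeroʳ c)))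
  ... | true  = ≤-trans (sparse y Py) (≤-reflexive (sym (*-identityʳ c)))

not-anyFin-not⇔ : ∀ k (f : Fin k → Bool) → not (anyFin k (λ i → not (f i))) ≡ true ⇔ (∀ i → f i ≡ true)
not-anyFin-not⇔ zero    f = mk⇔ (λ _ ()) (λ _ → refl)
not-anyFin-not⇔ (suc k) f with f zero in f0
... | false = mk⇔ (λ ()) (λ f≡true → case trans (sym f0) (f≡true zero) of λ ())
... | true  = mk⇔ (λ h → λ { zero → f0 ; (suc i) → to rest h i }) (λ f≡true → from rest (f≡true ∘ suc))
  where
  rest = not-anyFin-not⇔ k (f ∘ suc)

cases≡true⇔ : ∀ b {c d} {P Q : Set} → c ≡ true ⇔ P → d ≡ true ⇔ Q →
              ((b ∧ c) ∨ (not b ∧ d)) ≡ true ⇔ ((b ≡ true → P) × (b ≡ false → Q))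
cases≡true⇔ true  {c} c⇔P _ =
  mk⇔ (λ h → (λ _ → to c⇔P (trans (sym (∨-identityʳ c)) h)) , (λ ()))
      (λ (p , _) → trans (∨-identityʳ c) (from c⇔P (p refl)))
cases≡true⇔ false _ d⇔Q = mk⇔ (λ h → (λ ()) , (λ _ → to d⇔Q h)) (λ (_ , q) → from d⇔Q (q refl))

≤ᵇ≡true⇔≤ : ∀ {i j} → (i ℤ.≤ᵇ j) ≡ true ⇔ i ℤ.≤ j
≤ᵇ≡true⇔≤ = mk⇔ (ℤ.≤ᵇ⇒≤ ∘ from T-≡) (to T-≡ ∘ ℤ.≤⇒≤ᵇ)

signed-count≡ : ∀ p q → ℤ.+ 1 ℤ.* ℤ.+ p ℤ.+ (-[1+ 0 ] ℤ.* ℤ.+ q ℤ.+ ℤ.+ 0) ≡ ℤ.+ p ℤ.- ℤ.+ q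
signed-count≡ p q = cong₂ ℤ._+_ (ℤ.*-identityˡ (ℤ.+ p)) (trans (ℤ.+-identityʳ _) (ℤ.-1*i≡-i (ℤ.+ q)))

signed-count≤ᵇ0⇔ : ∀ p q → (ℤ.+ 1 ℤ.* ℤ.+ p ℤ.+ (-[1+ 0 ] ℤ.* ℤ.+ q ℤ.+ ℤ.+ 0) ℤ.≤ᵇ ℤ.+ 0) ≡ true ⇔ p ≤ q
signed-count≤ᵇ0⇔ p q rewrite signed-count≡ p q =
  mk⇔ (ℤ.drop‿+≤+ ∘ ℤ.i-j≤0⇒i≤j ∘ to ≤ᵇ≡true⇔≤) (from ≤ᵇ≡true⇔≤ ∘ ℤ.i≤j⇒i-j≤0 ∘ ℤ.+≤+)

count≥ᵇ1⇔ : ∀ p → (ℤ.+ 1 ℤ.≤ᵇ ℤ.+ 1 ℤ.* ℤ.+ p ℤ.+ ℤ.+ 0) ≡ true ⇔ 1 ≤ p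
count≥ᵇ1⇔ p rewrite ℤ.+-identityʳ (ℤ.+ 1 ℤ.* ℤ.+ p) | ℤ.*-identityˡ (ℤ.+ p) =
  mk⇔ (ℤ.drop‿+≤+ ∘ to ≤ᵇ≡true⇔≤) (from ≤ᵇ≡true⇔≤ ∘ ℤ.+≤+)

module _ {I : Set} (α β : I) where

  QuadraticallyBounded LinearlyBounded : ((I → ℕ) → Set) → Set
  QuadraticallyBounded S = ∀ v → S v → v β ≤ v α * v α
  LinearlyBounded      S = Σ ℕ λ c → ∀ v → S v → v β ≤ c + c * v α

  linearSet-quadratic⇒linear : (L : LinearSet I) → QuadraticallyBounded (_∈L L) → LinearlyBounded (_∈L L)
  linearSet-quadratic⇒linear L quadratic = c , bound
    where
    open LinearSet L
    open ≤-Reasoning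

    point : (Fin nper → ℕ) → I → ℕ
    point λs i = base i + sumFin nper (λ k → λs k * period k i)

    onAxis : Fin nper → ℕ → Fin nper → ℕ
    onAxis k t j = if does (j ≟ k) then t else 0

    point-onAxis : ∀ k t i → point (onAxis k t) i ≡ base i + t * period k i
    point-onAxis k t i = cong (base i +_) (trans (sumFin-supported k _ off-axis) on-axis)
      where
      off-axis : ∀ j → j ≢ k → onAxis k t j * period j i ≡ 0
      off-axis j j≢k rewrite dec-false (j ≟ k) j≢k = refl
      on-axis : onAxis k t k * period k i ≡ t * period k i
      on-axis rewrite dec-true (k ≟ k) refl = refl

    period-α≡0⇒period-β≡0 : ∀ k → period k α ≡ 0 → period k β ≡ 0
    period-α≡0⇒period-β≡0 k pα≡0 = n<1⇒n≡0 (*-cancelˡ-< t _ 1 (begin-strict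
      t * period k β                               ≤⟨ m≤n+m _ (base β) ⟩
      base β + t * period k β                      ≡⟨ point-onAxis k t β ⟨
      point (onAxis k t) β                         ≤⟨ quadratic _ (onAxis k t , λ _ → refl) ⟩
      point (onAxis k t) α * point (onAxis k t) α  ≡⟨ cong (λ x → x * x) α-unmoved ⟩
      base α * base α                              <⟨ n<1+n _ ⟩
      t                                            ≡⟨ *-identityʳ t ⟨
      t * 1                                        ∎))
      where
      t = suc (base α * base α)
      α-unmoved : point (onAxis k t) α ≡ base α
      α-unmoved rewrite point-onAxis k t α | pα≡0 | *-zeroʳ t = +-identityʳ (base α)

    P c : ℕ
    P = sumFin nper (λ k → period k β)
    c = base β + P

    term-bound : ∀ (λs : Fin nper → ℕ) k → λs k * period k β ≤ P * (λs k * period k α)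
    term-bound λs k with period k α in pα
    ... | zero    rewrite period-α≡0⇒period-β≡0 k pα | *-zeroʳ (λs k) = z≤n
    ... | suc p-1 = begin
      λs k * period k β    ≤⟨ *-monoʳ-≤ (λs k) (≤-sumFin _ k) ⟩
      λs k * P             ≡⟨ *-comm (λs k) P ⟩
      P * λs k             ≤⟨ *-monoʳ-≤ P (m≤m*n (λs k) (suc p-1)) ⟩
      P * (λs k * suc p-1) ∎

    point-bound : ∀ (λs : Fin nper → ℕ) → point λs β ≤ base β + P * point λs α
    point-bound λs = +-monoʳ-≤ (base β) (begin
      sumFin nper (λ k → λs k * period k β)       ≤⟨ sumFin-mono nper (term-bound λs) ⟩
      sumFin nper (λ k → P * (λs k * period k α)) ≡⟨ sumFin-*ˡ nper P _ ⟨
      P * sumFin nper (λ k → λs k * period k α)   ≤⟨ *-monoʳ-≤ P (m≤n+m _ (base α)) ⟩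
      P * point λs α                              ∎)

    bound : ∀ v → v ∈L L → v β ≤ c + c * v α
    bound v (λs , v≡point) = begin
      v β                      ≡⟨ v≡point β ⟩
      point λs β               ≤⟨ point-bound λs ⟩
      base β + P * point λs α  ≡⟨ cong (λ x → base β + P * x) (v≡point α) ⟨
      base β + P * v α         ≤⟨ +-mono-≤ (m≤m+n (base β) P) (*-monoˡ-≤ (v α) (m≤n+m P (base β))) ⟩
      c + c * v α              ∎

  semilinear-quadratic⇒linear : ∀ {S} → Semilinear S → QuadraticallyBounded S → LinearlyBounded S
  semilinear-quadratic⇒linear {S} (r , L , S⇔⋃L) quadratic = c , bound
    where
    bounds : ∀ j → LinearlyBounded (_∈L L j)
    bounds j = linearSet-quadratic⇒linear (L j) (λ v v∈Lj → quadratic v (proj₂ (S⇔⋃L v) (j , v∈Lj)))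
    c : ℕ
    c = sumFin r (proj₁ ∘ bounds)
    bound : ∀ v → S v → v β ≤ c + c * v α
    bound v v∈S with proj₁ (S⇔⋃L v) v∈S
    ... | j , v∈Lj = ≤-trans (proj₂ (bounds j) v v∈Lj) (+-mono-≤ cj≤c (*-monoˡ-≤ (v α) cj≤c))
      where
      cj≤c = ≤-sumFin (proj₁ ∘ bounds) j

loopAt : Var → Formula 0 1
loopAt v = binary zero v v

forAll : ∀ {n m} → Var → Formula n m → Formula n m
forAll v χ = neg (ex v (neg χ))

-- #_y[R(x,y) ∧ ¬L(y)] − #_y[R(x,y) ∧ L(y)] ≤ 0
balanced : Formula 0 1
balanced = count vy 2 (ℤ.+ 1 ∷ -[1+ 0 ] ∷ []) (λ _ → zero) (λ _ → fwd)
                 (neg (loopAt vy) ∷ loopAt vy ∷ []) c≤ (ℤ.+ 0)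

fed : Formula 0 1
fed = count vy 1 (λ _ → ℤ.+ 1) (λ _ → zero) (λ _ → bwd) (λ _ → loopAt vy) c≥ (ℤ.+ 1)

ψ : Formula 0 1
ψ = disj (conj (loopAt vx) balanced) (conj (neg (loopAt vx)) fed)

φ : Formula 0 1
φ = forAll vx ψ

φ-sentence : Sentence φ
φ-sentence = (refl , (tt , λ { zero → tt ; (suc zero) → tt }) , (tt , λ _ → tt)) , refl , refl

module _ (A : Structure 0 1) where

  loop : Dom A → Bool
  loop x = R A zero x x

  loops nonLoops : ℕ
  loops    = countFin (suc (N A)) loop
  nonLoops = countFin (suc (N A)) (λ x → not (loop x))

  loopsOut nonLoopsOut loopsIn : Dom A → ℕ
  loopsOut    x = countFin (suc (N A)) (λ y → R A zero x y ∧ loop y)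
  nonLoopsOut x = countFin (suc (N A)) (λ y → R A zero x y ∧ not (loop y))
  loopsIn     x = countFin (suc (N A)) (λ y → R A zero y x ∧ loop y)

  Ψ : Dom A → Set
  Ψ x = (loop x ≡ true → nonLoopsOut x ≤ loopsOut x) × (loop x ≡ false → 1 ≤ loopsIn x)

  ψ⇔Ψ : ∀ ρ x → eval A ψ (upd ρ vx x) ≡ true ⇔ Ψ x
  ψ⇔Ψ ρ x = cases≡true⇔ (loop x) (signed-count≤ᵇ0⇔ (nonLoopsOut x) (loopsOut x)) (count≥ᵇ1⇔ (loopsIn x))

  ⊨φ⇔Ψ : A ⊨ φ ⇔ (∀ x → Ψ x)
  ⊨φ⇔Ψ = mk⇔ (λ A⊨φ x → to (ψ⇔Ψ ρ₀ x) (to (φ⇔ψ-everywhere ρ₀) (A⊨φ ρ₀) x))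
              (λ Ψ-everywhere ρ → from (φ⇔ψ-everywhere ρ) (λ x → from (ψ⇔Ψ ρ x) (Ψ-everywhere x)))
    where
    ρ₀ : Var → Dom A
    ρ₀ _ = zero
    φ⇔ψ-everywhere : ∀ ρ → eval A φ ρ ≡ true ⇔ (∀ x → eval A ψ (upd ρ vx x) ≡ true)
    φ⇔ψ-everywhere ρ = not-anyFin-not⇔ (suc (N A)) (λ x → eval A ψ (upd ρ vx x))

  nonLoops≤loops² : A ⊨ φ → nonLoops ≤ loops * loops
  nonLoops≤loops² A⊨φ = double-counting _ _ loop (λ x → not (loop x)) (R A zero) loops covered sparse
    where
    Ψ-everywhere = to ⊨φ⇔Ψ A⊨φ
    covered : ∀ x → not (loop x) ≡ true → 1 ≤ countFin (suc (N A)) (λ y → loop y ∧ R A zero y x)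
    covered x ¬loop = ≤-trans (proj₂ (Ψ-everywhere x) (not-injective {y = false} ¬loop))
                              (≤-reflexive (countFin-cong _ (λ y → ∧-comm (R A zero y x) (loop y))))
    sparse : ∀ y → loop y ≡ true → nonLoopsOut y ≤ loops
    sparse y loop-y = ≤-trans (proj₁ (Ψ-everywhere y) loop-y)
                              (countFin-mono _ (λ x → ∧-conicalʳ (R A zero y x) (loop x)))

loopType : Bool → OneType 0 1
loopType b = (λ ()) , (λ _ → b)

spectrumVector : ℕ → ℕ → OneType 0 1 → ℕ
spectrumVector l k (_ , r) = if r zero then l else k

spectrumVector-counts : ∀ A τ →
                        spectrumVector (loops A) (nonLoops A) τ ≡ countFin (suc (N A)) (λ x → realizes A x τ)
spectrumVector-counts A (_ , r) =
  trans (count-if (r zero)) (countFin-cong _ (λ x → sym (realizes≡ (loop A x) (r zero))))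
  where
  count-if : ∀ b → (if b then loops A else nonLoops A)
                     ≡ countFin _ (λ x → if b then loop A x else not (loop A x))
  count-if true  = refl
  count-if false = refl
  -- realizes A x (_ , r) unfolds to (loop A x ==ᵇ r zero) ∧ true
  realizes≡ : ∀ l b → ((l ==ᵇ b) ∧ true) ≡ (if b then l else not l)
  realizes≡ true  true  = refl
  realizes≡ true  false = refl
  realizes≡ false true  = refl
  realizes≡ false false = refl

spectrum-quadratic : QuadraticallyBounded (loopType true) (loopType false) (Spectrum φ)
spectrum-quadratic v (A , A⊨φ , v≡) =
  subst₂ (λ b a → b ≤ a * a) (counts (loopType false)) (counts (loopType true)) (nonLoops≤loops² A A⊨φ)
  where
  counts : ∀ τ → spectrumVector (loops A) (nonLoops A) τ ≡ v τ
  counts τ = trans (spectrumVector-counts A τ) (sym (v≡ τ))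

-- A model with a looped and a * a loopless elements, for a = suc k

module Square (k : ℕ) where

  a : ℕ
  a = suc k

  Code : Set
  Code = Fin a ⊎ Fin a × Fin a

  code : Fin (a + a * a) → Code
  code = decode a a a

  -- inj₁ i is the i-th looped element, inj₂ (i , j) the j-th element of the block fed by it
  edge : Code → Code → Bool
  edge (inj₁ _) (inj₁ _)        = true
  edge (inj₁ i) (inj₂ (i′ , _)) = does (i′ ≟ i)
  edge (inj₂ _) _               = false

  square : Structure 0 1
  square = record { N = k + a * a ; U = λ () ; R = λ _ x y → edge (code x) (code y) }

  countCodes : (Code → Bool) → ℕ
  countCodes g = countFin a (g ∘ inj₁) + sumFin a (λ i → countFin a (λ j → g (inj₂ (i , j))))

  countFin-code : ∀ g → countFin (a + a * a) (g ∘ code) ≡ countCodes g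
  countFin-code g = sumFin-decode a a a (λ c → if g c then 1 else 0)

  loops-square : loops square ≡ a
  loops-square = begin
    loops square
      ≡⟨ countFin-code (λ c → edge c c) ⟩
    countFin a (λ _ → true) + sumFin a (λ _ → countFin a (λ _ → false))
      ≡⟨ cong₂ _+_ (countFin-true a) (sumFin-zero a (λ _ → countFin-false a)) ⟩
    a + 0
      ≡⟨ +-identityʳ a ⟩
    a ∎
    where open ≡-Reasoning

  nonLoops-square : nonLoops square ≡ a * a
  nonLoops-square = begin
    nonLoops square
      ≡⟨ countFin-code (λ c → not (edge c c)) ⟩
    countFin a (λ _ → false) + sumFin a (λ _ → countFin a (λ _ → true))
      ≡⟨ cong₂ _+_ (countFin-false a) (sumFin-cong a (λ _ → countFin-true a)) ⟩
    sumFin a (λ _ → a)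
      ≡⟨ sumFin-const a a ⟩
    a * a ∎
    where open ≡-Reasoning

  block-size : ∀ i → sumFin a (λ i′ → countFin a (λ _ → does (i′ ≟ i) ∧ true)) ≡ a
  block-size i = trans (sumFin-supported i _ off-block) in-block
    where
    off-block : ∀ i′ → i′ ≢ i → countFin a (λ _ → does (i′ ≟ i) ∧ true) ≡ 0
    off-block i′ i′≢i rewrite dec-false (i′ ≟ i) i′≢i = countFin-false a
    in-block : countFin a (λ _ → does (i ≟ i) ∧ true) ≡ a
    in-block rewrite dec-true (i ≟ i) refl = countFin-true a

  balanced-code : ∀ c → edge c c ≡ true →
                  countCodes (λ d → edge c d ∧ not (edge d d)) ≤ countCodes (λ d → edge c d ∧ edge d d)
  balanced-code (inj₁ i) _ = begin
    countFin a (λ _ → false) + sumFin a (λ i′ → countFin a (λ _ → does (i′ ≟ i) ∧ true))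
      ≡⟨ cong₂ _+_ (countFin-false a) (block-size i) ⟩
    a
      ≡⟨ countFin-true a ⟨
    countFin a (λ _ → true)
      ≤⟨ m≤m+n _ _ ⟩
    countFin a (λ _ → true) + sumFin a (λ i′ → countFin a (λ _ → does (i′ ≟ i) ∧ false)) ∎
    where open ≤-Reasoning

  fed-code : ∀ c → edge c c ≡ false → 1 ≤ countCodes (λ d → edge d c ∧ edge d d)
  fed-code (inj₂ (i , _)) _ =
    ≤-trans (1≤countFin {f = feeders} i (cong (_∧ true) (dec-true (i ≟ i) refl)))
            (m≤m+n (countFin a feeders) _)
    where
    feeders : Fin a → Bool
    feeders i′ = does (i ≟ i′) ∧ true

  square⊨φ : square ⊨ φ
  square⊨φ = from (⊨φ⇔Ψ square) (λ x → balanced-square x , fed-square x)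
    where
    balanced-square : ∀ x → loop square x ≡ true → nonLoopsOut square x ≤ loopsOut square x
    balanced-square x loop-x =
      subst₂ _≤_ (sym (countFin-code (λ d → edge (code x) d ∧ not (edge d d))))
                 (sym (countFin-code (λ d → edge (code x) d ∧ edge d d)))
                 (balanced-code (code x) loop-x)
    fed-square : ∀ x → loop square x ≡ false → 1 ≤ loopsIn square x
    fed-square x ¬loop-x =
      subst (1 ≤_) (sym (countFin-code (λ d → edge d (code x) ∧ edge d d))) (fed-code (code x) ¬loop-x)

  square∈spectrum : Spectrum φ (spectrumVector a (a * a))
  square∈spectrum = square , square⊨φ , λ τ →
    trans (cong₂ (λ l m → spectrumVector l m τ) (sym loops-square) (sym nonLoops-square))
          (spectrumVector-counts square τ)

spectrum-not-linearlyBounded : ¬ LinearlyBounded (loopType true) (loopType false) (Spectrum φ)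
spectrum-not-linearlyBounded (c , bound) = n≮n _ (bound _ (Square.square∈spectrum c))

theorem39 : Σ ℕ λ n → Σ ℕ λ m → Σ (Formula n m) λ φ →
    Sentence φ × ¬ Semilinear (Spectrum φ)
theorem39 = 0 , 1 , φ , φ-sentence , λ semilinear →
  spectrum-not-linearlyBounded (semilinear-quadratic⇒linear _ _ semilinear spectrum-quadratic)
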